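{- Let $M$ be a matroid and $t\in\mathbb{N}$. If $\tau(M)<\infty$, then $\tau(M^t)=t(\tau(M)-1)+1$.
   Context: A cyclic flat of a matroid $M$ is a flat $F$ such that $M|F$ has no coloops; $\mathcal{Z}(M)$ denotes the set of cyclic flats, and a matroid is determined by its cyclic flats and their ranks. The $t$-expansion: fix $t\in\mathbb{N}$; for each $e\in E(M)$ let $S_e$ be a $t$-element set with $e\in S_e$, the sets $S_e$ pairwise disjoint; for $X\subseteq E(M)$ let $S_X=\bigcup_{e\in X}S_e$. The $t$-expansion $M^t$ is the matroid on $S_{E(M)}$ whose cyclic flats are exactly the sets $S_A$ with $A\in\mathcal{Z}(M)$, with $r_{M^t}(S_A)=t\cdot r_M(A)$. For $X\subseteq E(M)$ let $\overline{X}=E(M)-X$ and $\lambda_M(X)=r(X)+r(\overline{X})-r(M)$. A $k$-separation ($k\in\mathbb{N}$) is a pair $(X,\overline{X})$ with $|X|,|\overline{X}|\geq k$ and $\lambda_M(X)<k$; the Tutte connectivity $\tau(M)$ is the least $k$ for which $M$ has a $k$-separation, and $\tau(M)=\infty$ if there is none. -}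

module Defs where

open import Data.Nat using (ℕ; _+_; _*_; _∸_; _≤_; _<_)
open import Data.Fin using (Fin)
open import Data.Fin.Subset using (Subset; _⊆_; _∪_; _∩_; ∁; ⁅_⁆; _-_; ∣_∣; ⊤; _∈_; _∉_)
open import Data.Vec using (tabulate; lookup)
open import Data.Product using (Σ; ∃; _×_; _,_)
open import Relation.Binary.PropositionalEquality using (_≡_)
open import Relation.Nullary using (¬_)
open import Function.Bundles using (_⇔_)

record Matroid (n : ℕ) : Set where
  field
    r        : Subset n → ℕ
    r-bound  : ∀ X → r X ≤ ∣ X ∣
    r-mono   : ∀ X Y → X ⊆ Y → r X ≤ r Y
    r-submod : ∀ X Y → r (X ∪ Y) + r (X ∩ Y) ≤ r X + r Y

open Matroid public

IsFlat : ∀ {n} → Matroid n → Subset n → Set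
IsFlat M F = ∀ e → e ∉ F → r M F < r M (F ∪ ⁅ e ⁆)

NoColoopsRestr : ∀ {n} → Matroid n → Subset n → Set
NoColoopsRestr M F = ∀ e → e ∈ F → r M (F - e) ≡ r M F

IsCyclicFlat : ∀ {n} → Matroid n → Subset n → Set
IsCyclicFlat M F = IsFlat M F × NoColoopsRestr M F

-- Connectivity function λ_M(X) = r(X) + r(E - X) - r(M)
-- (truncated subtraction; the value is nonnegative by submodularity anyway).
conn : ∀ {n} → Matroid n → Subset n → ℕ
conn M X = (r M X + r M (∁ X)) ∸ r M ⊤

IsSeparation : ∀ {n} → Matroid n → ℕ → Subset n → Set
IsSeparation M k X = k ≤ ∣ X ∣ × k ≤ ∣ ∁ X ∣ × conn M X < k

-- τ(M) = k  (in particular τ(M) < ∞): M has a k-separation and no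
-- j-separation for any j < k.
TutteConnIs : ∀ {n} → Matroid n → ℕ → Set
TutteConnIs M k = (∃ λ X → IsSeparation M k X)
                × (∀ j → j < k → ∀ X → ¬ IsSeparation M j X)

FiniteTutteConn : ∀ {n} → Matroid n → Set
FiniteTutteConn M = ∃ λ k → ∃ λ X → IsSeparation M k X

-- Expansion sets: the ground set Fin m of the expansion is partitioned into
-- the fibres S_e = π⁻¹(e), e ∈ Fin n; S_X = π⁻¹(X).
S[_] : ∀ {m n} → (Fin m → Fin n) → Subset n → Subset m
S[ π ] X = tabulate (λ i → lookup X (π i))

IsExpansion : ∀ {n m} (t : ℕ) → Matroid n → Matroid m → (Fin m → Fin n) → Set
IsExpansion {n} {m} t M N π =
    (∀ (e : Fin n) → ∣ S[ π ] ⁅ e ⁆ ∣ ≡ t)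
  × (∀ (Z : Subset m) → IsCyclicFlat N Z ⇔ (∃ λ A → IsCyclicFlat M A × Z ≡ S[ π ] A))
  × (∀ (A : Subset n) → IsCyclicFlat M A → r N (S[ π ] A) ≡ t * r M A)

{-# OPTIONS --safe #-}
-- A set Y of M^t has rank at least t·r(A) + |Y − S_A| for some cyclic flat A of M
-- (r(Y) = min over cyclic flats Z of r(Z) + |Y − Z|, and the cyclic flats of M^t are the S_A),
-- while r(S_X) ≤ t·r(X).  Hence S_X turns a k-separation of M into a (t(k−1)+1)-separation
-- of M^t.  Conversely, let (Y, Ȳ) be a j-separation of M^t with j ≤ t(k−1), with cyclic
-- flats A for Y and B for Ȳ.  Every X with A − B ⊆ X ⊆ E − (B − A) satisfies
-- t·λ(X) + |Y ∩ S_{B−A}| + |Ȳ ∩ S_{A−B}| ≤ λ(Y) < j, so λ(X) < k − 1 and, as τ(M) = k,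
-- X or E − X has at most λ(X) elements.  The size bounds |Y|, |Ȳ| ≥ j force A − B to be
-- the small side and E − (B − A) the large one; a set of size exactly k − 1 in between is
-- neither, a contradiction.
module Submission where

open import Data.Bool.Base using (Bool; true; false; not; _∧_; _∨_)
open import Data.Bool.Properties using (∧-zeroʳ; ∧-identityʳ)
open import Data.Empty using (⊥; ⊥-elim)
open import Data.Fin.Base using (Fin; zero; suc)
open import Data.Fin.Properties using (any?; _≟_)
open import Data.Fin.Subset
  using (Subset; _⊆_; _∪_; _∩_; ∁; ⁅_⁆; _-_; _─_; ∣_∣; ⊤; _∈_; _∉_)
open import Data.Fin.Subset.Properties
  using ( ⊆-refl; ⊆-trans; in⊆in; out⊆; drop-∷-⊆; p⊆p∪q; q⊆p∪q; p─q⊆p; p∪∁p≡⊤; _∈?_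
        ; x∈p∩q⁺; x∉p⇒x∈∁p; x∈p∧x∉q⇒x∈p─q; x∈p∧x≢y⇒x∈p-y; x∈⁅x⁆
        ; p⊆q⇒∣p∣≤∣q∣; p⊂q⇒∣p∣<∣q∣; p⊂q⇒∁p⊃∁q; x∈p⇒∣p-x∣<∣p∣; ∣∁p∣≡n∸∣p∣; ∣p∣≤n; ∣⁅x⁆∣≡1 )
open import Data.List.Base using (List; []; _∷_)
open import Data.Nat.Base
open import Data.Nat.Induction using (<-wellFounded)
open import Data.Nat.Properties hiding (_≟_)
open import Data.Nat.Tactic.RingSolver using (solve-∀)
open import Data.Product.Base using (Σ; ∃; _×_; _,_)
open import Data.Sum.Base using (_⊎_; inj₁; inj₂; [_,_]′)
open import Data.Vec.Base using (Vec; []; _∷_; here; lookup; tabulate; zipWith)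
open import Data.Vec.Properties
  using ( []=⇒lookup; lookup⇒[]=; lookup-zipWith; lookup-map; lookup-replicate
        ; lookup∘tabulate; tabulate∘lookup; tabulate-cong )
open import Function.Base using (_∘_)
open import Function.Bundles using (Equivalence)
open import Induction.WellFounded using (Acc; acc)
open import Relation.Binary.PropositionalEquality
open import Relation.Nullary using (¬_; Dec; yes; no; contradiction)
open import Relation.Nullary.Decidable using (_×-dec_; ¬?)
open import Algebra.Properties.CommutativeSemigroup +-commutativeSemigroup using (interchange)
open import Algebra.Properties.Semiring.Sum +-*-semiring
  using (sum; sum-syntax; sum-cong-≗; sum-replicate-zero; ∑-distrib-+; ∑-comm; *-distribˡ-sum)

open import Defs

private variable
  n m : ℕ

-- Subsets as Boolean vectors

𝟙 : Bool → ℕ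
𝟙 true  = 1
𝟙 false = 0

lookup-⊆ : ∀ {p q : Subset n} {i} → p ⊆ q → lookup p i ≡ true → lookup q i ≡ true
lookup-⊆ {p = p} {i = i} p⊆q = []=⇒lookup ∘ p⊆q ∘ lookup⇒[]= i p

lookup-∩ : ∀ (p q : Subset n) i → lookup (p ∩ q) i ≡ lookup p i ∧ lookup q i
lookup-∩ p q i = lookup-zipWith _∧_ i p q

lookup-∪ : ∀ (p q : Subset n) i → lookup (p ∪ q) i ≡ lookup p i ∨ lookup q i
lookup-∪ p q i = lookup-zipWith _∨_ i p q

lookup-∁ : ∀ (p : Subset n) i → lookup (∁ p) i ≡ not (lookup p i)
lookup-∁ p i = lookup-map i not p

lookup-─ : ∀ (p q : Subset n) i → lookup (p ─ q) i ≡ lookup p i ∧ not (lookup q i)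
lookup-─ (a ∷ p) (true  ∷ q) zero    = sym (∧-zeroʳ a)
lookup-─ (a ∷ p) (false ∷ q) zero    = sym (∧-identityʳ a)
lookup-─ (a ∷ p) (b     ∷ q) (suc i) = lookup-─ p q i

x∈p─q⇒x∉q : ∀ {p q : Subset n} {x} → x ∈ p ─ q → x ∉ q
x∈p─q⇒x∉q {p = p} {q} {x} x∈p─q x∈q = contradiction true≡false λ ()
  where
  open ≡-Reasoning
  true≡false : true ≡ false
  true≡false = begin
    true                          ≡⟨ []=⇒lookup x∈p─q ⟨
    lookup (p ─ q) x              ≡⟨ lookup-─ p q x ⟩
    lookup p x ∧ not (lookup q x) ≡⟨ cong (λ b → lookup p x ∧ not b) ([]=⇒lookup x∈q) ⟩
    lookup p x ∧ false            ≡⟨ ∧-zeroʳ (lookup p x) ⟩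
    false                         ∎

─-monoˡ-⊆ : ∀ {p q s : Subset n} → p ⊆ q → p ─ s ⊆ q ─ s
─-monoˡ-⊆ {p = p} {s = s} p⊆q x∈p─s = x∈p∧x∉q⇒x∈p─q (p⊆q (p─q⊆p p s x∈p─s)) (x∈p─q⇒x∉q x∈p─s)

x∉p⇒p⊆p-x : ∀ {p : Subset n} {x} → x ∉ p → p ⊆ p - x
x∉p⇒p⊆p-x {p = p} x∉p y∈p = x∈p∧x≢y⇒x∈p-y y∈p (λ y≡x → x∉p (subst (_∈ p) y≡x y∈p))

─-monoʳ-⊆ : ∀ {p q s : Subset n} → q ⊆ s → p ─ s ⊆ p ─ q
─-monoʳ-⊆ {p = p} {s = s} q⊆s x∈p─s = x∈p∧x∉q⇒x∈p─q (p─q⊆p p s x∈p─s) (x∈p─q⇒x∉q x∈p─s ∘ q⊆s)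

p⊆q∪[p─q] : ∀ (p q : Subset n) → p ⊆ q ∪ (p ─ q)
p⊆q∪[p─q] p q {x} x∈p with x ∈? q
... | yes x∈q = p⊆p∪q (p ─ q) x∈q
... | no  x∉q = q⊆p∪q q (p ─ q) (x∈p∧x∉q⇒x∈p─q x∈p x∉q)

-- Counting

∣∣≡∑𝟙 : (p : Subset n) → ∣ p ∣ ≡ ∑[ i < n ] 𝟙 (lookup p i)
∣∣≡∑𝟙 []          = refl
∣∣≡∑𝟙 (true  ∷ p) = cong suc (∣∣≡∑𝟙 p)
∣∣≡∑𝟙 (false ∷ p) = ∣∣≡∑𝟙 p

∑-mono-≤ : {f g : Fin n → ℕ} → (∀ i → f i ≤ g i) → sum f ≤ sum g
∑-mono-≤ {zero}  f≤g = z≤n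
∑-mono-≤ {suc n} f≤g = +-mono-≤ (f≤g zero) (∑-mono-≤ (f≤g ∘ suc))

∣p─p∣≡0 : (p : Subset n) → ∣ p ─ p ∣ ≡ 0
∣p─p∣≡0 []          = refl
∣p─p∣≡0 (true  ∷ p) = ∣p─p∣≡0 p
∣p─p∣≡0 (false ∷ p) = ∣p─p∣≡0 p

size : List (Subset n) → ℕ
size []       = 0
size (p ∷ ps) = ∣ p ∣ + size ps

multiplicity : List (Subset n) → Fin n → ℕ
multiplicity []       i = 0
multiplicity (p ∷ ps) i = 𝟙 (lookup p i) + multiplicity ps i

size≡∑multiplicity : (ps : List (Subset n)) → size ps ≡ ∑[ i < n ] multiplicity ps i
size≡∑multiplicity {n} [] = sym (sum-replicate-zero n)
size≡∑multiplicity (p ∷ ps) = begin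
  ∣ p ∣ + size ps                                        ≡⟨ cong₂ _+_ (∣∣≡∑𝟙 p) (size≡∑multiplicity ps) ⟩
  sum (λ i → 𝟙 (lookup p i)) + sum (multiplicity ps)    ≡⟨ ∑-distrib-+ (λ i → 𝟙 (lookup p i)) (multiplicity ps) ⟨
  sum (multiplicity (p ∷ ps))                           ∎
  where open ≡-Reasoning

multiplicity-≤⇒size-≤ : (ps qs : List (Subset n)) →
            (∀ i → multiplicity ps i ≤ multiplicity qs i) → size ps ≤ size qs
multiplicity-≤⇒size-≤ ps qs le = begin
  size ps                    ≡⟨ size≡∑multiplicity ps ⟩
  sum (multiplicity ps)      ≤⟨ ∑-mono-≤ le ⟩
  sum (multiplicity qs)      ≡⟨ size≡∑multiplicity qs ⟨
  size qs                    ∎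
  where open ≤-Reasoning

∣p∣+∣∁p∣≡n : (p : Subset n) → ∣ p ∣ + ∣ ∁ p ∣ ≡ n
∣p∣+∣∁p∣≡n p = trans (cong (∣ p ∣ +_) (∣∁p∣≡n∸∣p∣ p)) (m+[n∸m]≡n (∣p∣≤n p))

∣p∪q∣≤∣p∣+∣q∣ : (p q : Subset n) → ∣ p ∪ q ∣ ≤ ∣ p ∣ + ∣ q ∣
∣p∪q∣≤∣p∣+∣q∣ p q = subst₂ _≤_ (+-identityʳ _) (cong (∣ p ∣ +_) (+-identityʳ _))
  (multiplicity-≤⇒size-≤ (p ∪ q ∷ []) (p ∷ q ∷ []) pointwise)
  where
  pointwise : ∀ i → 𝟙 (lookup (p ∪ q) i) + 0 ≤ 𝟙 (lookup p i) + (𝟙 (lookup q i) + 0)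
  pointwise i rewrite lookup-∪ p q i = table (lookup p i) (lookup q i)
    where
    table : ∀ a b → 𝟙 (a ∨ b) + 0 ≤ 𝟙 a + (𝟙 b + 0)
    table true  b = s≤s z≤n
    table false b = ≤-refl

∣p∣≤∣∁q∣+∣p∩q∣ : (p q : Subset n) → ∣ p ∣ ≤ ∣ ∁ q ∣ + ∣ p ∩ q ∣
∣p∣≤∣∁q∣+∣p∩q∣ p q = ≤-trans (p⊆q⇒∣p∣≤∣q∣ split) (∣p∪q∣≤∣p∣+∣q∣ (∁ q) (p ∩ q))
  where
  split : p ⊆ ∁ q ∪ (p ∩ q)
  split {x} x∈p with x ∈? q
  ... | yes x∈q = q⊆p∪q (∁ q) (p ∩ q) (x∈p∩q⁺ (x∈p , x∈q))
  ... | no  x∉q = p⊆p∪q (p ∩ q) (x∉p⇒x∈∁p x∉q)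

interval-count : ∀ (a b x y : Subset n) → a ─ b ⊆ x → x ⊆ ∁ (b ─ a) →
  ∣ x ─ a ∣ + (∣ ∁ x ─ b ∣ + (∣ y ∩ (b ─ a) ∣ + ∣ ∁ y ∩ (a ─ b) ∣)) ≤ ∣ y ─ a ∣ + ∣ ∁ y ─ b ∣
interval-count a b x y a─b⊆x x⊆∁b─a =
  subst₂ _≤_ (cong (λ k → ∣ x ─ a ∣ + (∣ ∁ x ─ b ∣ + (∣ y ∩ (b ─ a) ∣ + k))) (+-identityʳ _))
             (cong (∣ y ─ a ∣ +_) (+-identityʳ _))
    (multiplicity-≤⇒size-≤ ((x ─ a) ∷ (∁ x ─ b) ∷ y ∩ (b ─ a) ∷ ∁ y ∩ (a ─ b) ∷ [])
                           ((y ─ a) ∷ (∁ y ─ b) ∷ []) pointwise)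
  where
  lower : ∀ i → lookup a i ∧ not (lookup b i) ≡ true → lookup x i ≡ true
  lower i = lookup-⊆ a─b⊆x ∘ trans (lookup-─ a b i)
  upper : ∀ i → lookup x i ≡ true → not (lookup b i ∧ not (lookup a i)) ≡ true
  upper i = trans (sym (trans (lookup-∁ (b ─ a) i) (cong not (lookup-─ b a i)))) ∘ lookup-⊆ x⊆∁b─a
  pointwise : ∀ i → multiplicity ((x ─ a) ∷ (∁ x ─ b) ∷ y ∩ (b ─ a) ∷ ∁ y ∩ (a ─ b) ∷ []) i
                  ≤ multiplicity ((y ─ a) ∷ (∁ y ─ b) ∷ []) i
  pointwise i
    rewrite lookup-─ x a i | lookup-─ (∁ x) b i | lookup-∁ x i
          | lookup-∩ y (b ─ a) i | lookup-─ b a i | lookup-∩ (∁ y) (a ─ b) i | lookup-─ a b i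
          | lookup-─ y a i | lookup-─ (∁ y) b i | lookup-∁ y i
    = table (lookup a i) (lookup b i) (lookup x i) (lookup y i) (lower i) (upper i)
    where
    table : ∀ a b x y → (a ∧ not b ≡ true → x ≡ true) → (x ≡ true → not (b ∧ not a) ≡ true) →
      𝟙 (x ∧ not a) + (𝟙 (not x ∧ not b) + (𝟙 (y ∧ (b ∧ not a)) + (𝟙 (not y ∧ (a ∧ not b)) + 0)))
        ≤ 𝟙 (y ∧ not a) + (𝟙 (not y ∧ not b) + 0)
    table true  false false _     h _ with () ← h refl
    table false true  true  _     _ h with () ← h refl
    table true  true  true  true  _ _ = ≤-refl
    table true  true  true  false _ _ = ≤-refl
    table true  true  false true  _ _ = ≤-refl
    table true  true  false false _ _ = ≤-refl
    table false false true  true  _ _ = ≤-refl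
    table false false true  false _ _ = ≤-refl
    table false false false true  _ _ = ≤-refl
    table false false false false _ _ = ≤-refl
    table true  false true  true  _ _ = ≤-refl
    table true  false true  false _ _ = ≤-refl
    table false true  false true  _ _ = ≤-refl
    table false true  false false _ _ = ≤-refl

interpolate : ∀ {p q : Subset n} {s} → p ⊆ q → ∣ p ∣ ≤ s → s ≤ ∣ q ∣ →
              ∃ λ x → p ⊆ x × x ⊆ q × ∣ x ∣ ≡ s
interpolate {p = []}      {[]}         _   _         z≤n       = [] , ⊆-refl , ⊆-refl , refl
interpolate {p = true ∷ p} {false ∷ q} p⊆q _         _         with () ← p⊆q here
interpolate {p = true ∷ p} {true ∷ q} p⊆q (s≤s ∣p∣≤s) (s≤s s≤∣q∣)
  with x , p⊆x , x⊆q , ∣x∣≡s ← interpolate (drop-∷-⊆ p⊆q) ∣p∣≤s s≤∣q∣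
  = true ∷ x , in⊆in p⊆x , in⊆in x⊆q , cong suc ∣x∣≡s
interpolate {p = false ∷ p} {false ∷ q} p⊆q ∣p∣≤s s≤∣q∣
  with x , p⊆x , x⊆q , ∣x∣≡s ← interpolate (drop-∷-⊆ p⊆q) ∣p∣≤s s≤∣q∣
  = false ∷ x , out⊆ p⊆x , out⊆ x⊆q , ∣x∣≡s
interpolate {p = false ∷ p} {true ∷ q} {s} p⊆q ∣p∣≤s s≤1+∣q∣ with s ≤? ∣ q ∣
... | no s≰∣q∣ = true ∷ q , p⊆q , ⊆-refl , ≤-antisym (≰⇒> s≰∣q∣) s≤1+∣q∣
... | yes s≤∣q∣
  with x , p⊆x , x⊆q , ∣x∣≡s ← interpolate (drop-∷-⊆ p⊆q) ∣p∣≤s s≤∣q∣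
  = false ∷ x , out⊆ p⊆x , out⊆ x⊆q , ∣x∣≡s

-- Preimages under the fibre map

≡-from-lookup : ∀ {A : Set} {xs ys : Vec A n} → (∀ i → lookup xs i ≡ lookup ys i) → xs ≡ ys
≡-from-lookup {xs = xs} {ys} eq = begin
  xs                 ≡⟨ tabulate∘lookup xs ⟨
  tabulate (lookup xs) ≡⟨ tabulate-cong eq ⟩
  tabulate (lookup ys) ≡⟨ tabulate∘lookup ys ⟩
  ys                 ∎
  where open ≡-Reasoning

∑-𝟙⁅⁆ : (g : Fin n → ℕ) (x : Fin n) → ∑[ e < n ] (g e * 𝟙 (lookup ⁅ e ⁆ x)) ≡ g x
∑-𝟙⁅⁆ {suc n} g zero    = begin
  g zero * 1 + ∑[ e < n ] (g (suc e) * 0) ≡⟨ cong₂ _+_ (*-identityʳ (g zero)) (sum-cong-≗ (*-zeroʳ ∘ g ∘ suc)) ⟩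
  g zero + ∑[ e < n ] 0                   ≡⟨ cong (g zero +_) (sum-replicate-zero n) ⟩
  g zero + 0                              ≡⟨ +-identityʳ (g zero) ⟩
  g zero                                  ∎
  where open ≡-Reasoning
∑-𝟙⁅⁆ {suc n} g (suc x) rewrite lookup-replicate x false | *-zeroʳ (g zero) = ∑-𝟙⁅⁆ (g ∘ suc) x

module _ (π : Fin m → Fin n) where

  lookup-S : ∀ X i → lookup (S[ π ] X) i ≡ lookup X (π i)
  lookup-S X i = lookup∘tabulate _ i

  S-zipWith : ∀ f X Y → S[ π ] (zipWith f X Y) ≡ zipWith f (S[ π ] X) (S[ π ] Y)
  S-zipWith f X Y = ≡-from-lookup λ i → begin
    lookup (S[ π ] (zipWith f X Y)) i                 ≡⟨ lookup-S (zipWith f X Y) i ⟩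
    lookup (zipWith f X Y) (π i)                      ≡⟨ lookup-zipWith f (π i) X Y ⟩
    f (lookup X (π i)) (lookup Y (π i))               ≡⟨ cong₂ f (lookup-S X i) (lookup-S Y i) ⟨
    f (lookup (S[ π ] X) i) (lookup (S[ π ] Y) i)     ≡⟨ lookup-zipWith f i (S[ π ] X) (S[ π ] Y) ⟨
    lookup (zipWith f (S[ π ] X) (S[ π ] Y)) i        ∎
    where open ≡-Reasoning

  S-∁ : ∀ X → S[ π ] (∁ X) ≡ ∁ (S[ π ] X)
  S-∁ X = ≡-from-lookup λ i → begin
    lookup (S[ π ] (∁ X)) i     ≡⟨ lookup-S (∁ X) i ⟩
    lookup (∁ X) (π i)          ≡⟨ lookup-∁ X (π i) ⟩
    not (lookup X (π i))        ≡⟨ cong not (lookup-S X i) ⟨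
    not (lookup (S[ π ] X) i)   ≡⟨ lookup-∁ (S[ π ] X) i ⟨
    lookup (∁ (S[ π ] X)) i     ∎
    where open ≡-Reasoning

  S-─ : ∀ X Y → S[ π ] (X ─ Y) ≡ S[ π ] X ─ S[ π ] Y
  S-─ X Y = S-zipWith _ X Y

  S-⊤ : S[ π ] ⊤ ≡ ⊤
  S-⊤ = ≡-from-lookup λ i →
    trans (lookup-S ⊤ i) (trans (lookup-replicate (π i) true) (sym (lookup-replicate i true)))

  S-mono : ∀ {X Y} → X ⊆ Y → S[ π ] X ⊆ S[ π ] Y
  S-mono {X} {Y} X⊆Y {i} i∈SX = lookup⇒[]= i (S[ π ] Y)
    (trans (lookup-S Y i) (lookup-⊆ X⊆Y (trans (sym (lookup-S X i)) ([]=⇒lookup i∈SX))))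

  ∣S∣≡∑ : ∀ X → ∣ S[ π ] X ∣ ≡ ∑[ i < m ] 𝟙 (lookup X (π i))
  ∣S∣≡∑ X = trans (∣∣≡∑𝟙 (S[ π ] X)) (sum-cong-≗ (cong 𝟙 ∘ lookup-S X))

  ∑∘π≡∑*∣fibre∣ : (g : Fin n → ℕ) → ∑[ i < m ] g (π i) ≡ ∑[ e < n ] (g e * ∣ S[ π ] ⁅ e ⁆ ∣)
  ∑∘π≡∑*∣fibre∣ g = begin
    ∑[ i < m ] g (π i)                                    ≡⟨ sum-cong-≗ (∑-𝟙⁅⁆ g ∘ π) ⟨
    ∑[ i < m ] ∑[ e < n ] (g e * 𝟙 (lookup ⁅ e ⁆ (π i)))  ≡⟨ ∑-comm (λ i e → g e * 𝟙 (lookup ⁅ e ⁆ (π i))) ⟩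
    ∑[ e < n ] ∑[ i < m ] (g e * 𝟙 (lookup ⁅ e ⁆ (π i)))
      ≡⟨ sum-cong-≗ (λ e → *-distribˡ-sum (g e) (λ i → 𝟙 (lookup ⁅ e ⁆ (π i)))) ⟨
    ∑[ e < n ] (g e * ∑[ i < m ] 𝟙 (lookup ⁅ e ⁆ (π i)))  ≡⟨ sum-cong-≗ (λ e → cong (g e *_) (∣S∣≡∑ ⁅ e ⁆)) ⟨
    ∑[ e < n ] (g e * ∣ S[ π ] ⁅ e ⁆ ∣)                   ∎
    where open ≡-Reasoning

  ∣S∣≡t*∣∣ : ∀ {t} → (∀ e → ∣ S[ π ] ⁅ e ⁆ ∣ ≡ t) → ∀ X → ∣ S[ π ] X ∣ ≡ t * ∣ X ∣
  ∣S∣≡t*∣∣ {t} fibre X = begin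
    ∣ S[ π ] X ∣                               ≡⟨ ∣S∣≡∑ X ⟩
    ∑[ i < m ] 𝟙 (lookup X (π i))              ≡⟨ ∑∘π≡∑*∣fibre∣ (𝟙 ∘ lookup X) ⟩
    ∑[ e < n ] (𝟙 (lookup X e) * ∣ S[ π ] ⁅ e ⁆ ∣)
      ≡⟨ sum-cong-≗ (λ e → trans (cong (𝟙 (lookup X e) *_) (fibre e)) (*-comm _ t)) ⟩
    ∑[ e < n ] (t * 𝟙 (lookup X e))            ≡⟨ *-distribˡ-sum t (𝟙 ∘ lookup X) ⟨
    t * ∑[ e < n ] 𝟙 (lookup X e)              ≡⟨ cong (t *_) (∣∣≡∑𝟙 X) ⟨
    t * ∣ X ∣                                  ∎
    where open ≡-Reasoning

-- Rank and cyclic flats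

module _ (M : Matroid n) where

  r-∪-≤ : ∀ X Y → r M (X ∪ Y) ≤ r M X + r M Y
  r-∪-≤ X Y = ≤-trans (m≤m+n _ _) (r-submod M X Y)

  r≤r+∣─∣ : ∀ X A → r M X ≤ r M A + ∣ X ─ A ∣
  r≤r+∣─∣ X A = begin
    r M X                   ≤⟨ r-mono M X _ (p⊆q∪[p─q] X A) ⟩
    r M (A ∪ (X ─ A))       ≤⟨ r-∪-≤ A (X ─ A) ⟩
    r M A + r M (X ─ A)     ≤⟨ +-monoʳ-≤ (r M A) (r-bound M (X ─ A)) ⟩
    r M A + ∣ X ─ A ∣       ∎
    where open ≤-Reasoning

  r⊤≤r+r∁ : ∀ X → r M ⊤ ≤ r M X + r M (∁ X)
  r⊤≤r+r∁ X = ≤-trans (≤-reflexive (cong (r M) (sym (p∪∁p≡⊤ X)))) (r-∪-≤ X (∁ X))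

  deleteColoops : ∀ Y → Acc _<_ ∣ Y ∣ →
                  ∃ λ W → NoColoopsRestr M W × W ⊆ Y × r M W + ∣ Y ─ W ∣ ≤ r M Y
  deleteColoops Y (acc rec) with any? (λ e → e ∈? Y ×-dec r M (Y - e) <? r M Y)
  ... | no noColoop =
    Y , noColoops , ⊆-refl , ≤-reflexive (trans (cong (r M Y +_) (∣p─p∣≡0 Y)) (+-identityʳ (r M Y)))
    where
    noColoops : NoColoopsRestr M Y
    noColoops e e∈Y = ≤-antisym (r-mono M _ _ (p─q⊆p Y ⁅ e ⁆)) (≮⇒≥ λ lt → noColoop (e , e∈Y , lt))
  ... | yes (e , e∈Y , coloop)
    with W , noColoops , W⊆Y-e , bound ← deleteColoops (Y - e) (rec (x∈p⇒∣p-x∣<∣p∣ e∈Y))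
    = W , noColoops , ⊆-trans W⊆Y-e (p─q⊆p Y ⁅ e ⁆) , (begin
      r M W + ∣ Y ─ W ∣                   ≤⟨ +-monoʳ-≤ (r M W) ∣Y─W∣≤ ⟩
      r M W + (∣ (Y - e) ─ W ∣ + 1)       ≡⟨ +-assoc (r M W) _ 1 ⟨
      r M W + ∣ (Y - e) ─ W ∣ + 1         ≤⟨ +-monoˡ-≤ 1 bound ⟩
      r M (Y - e) + 1                     ≡⟨ +-comm (r M (Y - e)) 1 ⟩
      suc (r M (Y - e))                   ≤⟨ coloop ⟩
      r M Y                               ∎)
    where
    open ≤-Reasoning
    Y─W⊆ : Y ─ W ⊆ ((Y - e) ─ W) ∪ ⁅ e ⁆
    Y─W⊆ {x} x∈Y─W with x ≟ e
    ... | yes refl = q⊆p∪q _ ⁅ e ⁆ (x∈⁅x⁆ e)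
    ... | no  x≢e  = p⊆p∪q ⁅ e ⁆
      (x∈p∧x∉q⇒x∈p─q (x∈p∧x≢y⇒x∈p-y (p─q⊆p Y W x∈Y─W) x≢e) (x∈p─q⇒x∉q x∈Y─W))
    ∣Y─W∣≤ : ∣ Y ─ W ∣ ≤ ∣ (Y - e) ─ W ∣ + 1
    ∣Y─W∣≤ = begin
      ∣ Y ─ W ∣                       ≤⟨ p⊆q⇒∣p∣≤∣q∣ Y─W⊆ ⟩
      ∣ ((Y - e) ─ W) ∪ ⁅ e ⁆ ∣        ≤⟨ ∣p∪q∣≤∣p∣+∣q∣ ((Y - e) ─ W) ⁅ e ⁆ ⟩
      ∣ (Y - e) ─ W ∣ + ∣ ⁅ e ⁆ ∣      ≡⟨ cong (∣ (Y - e) ─ W ∣ +_) (∣⁅x⁆∣≡1 e) ⟩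
      ∣ (Y - e) ─ W ∣ + 1             ∎

  noColoops-∪ : ∀ {W e} → NoColoopsRestr M W → r M (W ∪ ⁅ e ⁆) ≡ r M W → NoColoopsRestr M (W ∪ ⁅ e ⁆)
  noColoops-∪ {W} {e} noColoops same g _ = ≤-antisym (r-mono M _ _ (p─q⊆p (W ∪ ⁅ e ⁆) ⁅ g ⁆)) (begin
    r M (W ∪ ⁅ e ⁆)      ≡⟨ same ⟩
    r M W                ≤⟨ lower (g ∈? W) ⟩
    r M (W ∪ ⁅ e ⁆ - g)  ∎)
    where
    open ≤-Reasoning
    lower : Dec (g ∈ W) → r M W ≤ r M (W ∪ ⁅ e ⁆ - g)
    lower (yes g∈W) = ≤-trans (≤-reflexive (sym (noColoops g g∈W))) (r-mono M _ _ (─-monoˡ-⊆ (p⊆p∪q ⁅ e ⁆)))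
    lower (no  g∉W) = r-mono M _ _ (⊆-trans (x∉p⇒p⊆p-x g∉W) (─-monoˡ-⊆ (p⊆p∪q ⁅ e ⁆)))

  closeToCyclicFlat : ∀ W → NoColoopsRestr M W → Acc _<_ ∣ ∁ W ∣ →
                      ∃ λ Z → IsCyclicFlat M Z × W ⊆ Z × r M Z ≡ r M W
  closeToCyclicFlat W noColoops (acc rec) with any? (λ e → ¬? (e ∈? W) ×-dec r M (W ∪ ⁅ e ⁆) ≤? r M W)
  ... | no noSpan = W , (flat , noColoops) , ⊆-refl , refl
    where
    flat : IsFlat M W
    flat e e∉W = ≰⇒> λ le → noSpan (e , e∉W , le)
  ... | yes (e , e∉W , spanned) =
    let Z , cyclicFlat , W∪e⊆Z , same = closeToCyclicFlat (W ∪ ⁅ e ⁆) (noColoops-∪ noColoops same′) (rec shrinks)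
    in  Z , cyclicFlat , ⊆-trans (p⊆p∪q ⁅ e ⁆) W∪e⊆Z , trans same same′
    where
    same′ : r M (W ∪ ⁅ e ⁆) ≡ r M W
    same′ = ≤-antisym spanned (r-mono M _ _ (p⊆p∪q ⁅ e ⁆))
    shrinks : ∣ ∁ (W ∪ ⁅ e ⁆) ∣ < ∣ ∁ W ∣
    shrinks = p⊂q⇒∣p∣<∣q∣ (p⊂q⇒∁p⊃∁q (p⊆p∪q ⁅ e ⁆ , e , q⊆p∪q W ⁅ e ⁆ (x∈⁅x⁆ e) , e∉W))

  cyclicFlat-bound : ∀ Y → ∃ λ Z → IsCyclicFlat M Z × r M Z + ∣ Y ─ Z ∣ ≤ r M Y
  cyclicFlat-bound Y with W , noColoops , W⊆Y , bound ← deleteColoops Y (<-wellFounded _)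
                     with Z , cyclicFlat , W⊆Z , same ← closeToCyclicFlat W noColoops (<-wellFounded _)
    = Z , cyclicFlat , (begin
      r M Z + ∣ Y ─ Z ∣ ≡⟨ cong (_+ ∣ Y ─ Z ∣) same ⟩
      r M W + ∣ Y ─ Z ∣ ≤⟨ +-monoʳ-≤ (r M W) (p⊆q⇒∣p∣≤∣q∣ {p = Y ─ Z} {q = Y ─ W} (─-monoʳ-⊆ W⊆Z)) ⟩
      r M W + ∣ Y ─ W ∣ ≤⟨ bound ⟩
      r M Y             ∎)
    where open ≤-Reasoning

  small⊎cosmall : ∀ {k} → (∀ j → j < k → ∀ X → ¬ IsSeparation M j X) →
                  ∀ X → suc (conn M X) < k → ∣ X ∣ ≤ conn M X ⊎ ∣ ∁ X ∣ ≤ conn M X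
  small⊎cosmall noSeparation X λ<k with suc (conn M X) ≤? ∣ X ∣ | suc (conn M X) ≤? ∣ ∁ X ∣
  ... | no  ∣X∣≤λ | _         = inj₁ (≤-pred (≰⇒> ∣X∣≤λ))
  ... | yes _     | no ∣∁X∣≤λ = inj₂ (≤-pred (≰⇒> ∣∁X∣≤λ))
  ... | yes big   | yes cobig = ⊥-elim (noSeparation _ λ<k X (big , cobig , ≤-refl))

-- Connectivity of the expansion

left-summand-large : ∀ {k a b} → suc k + suc k ≤ a + b → b ≤ k → k < a
left-summand-large {k} 2k+2≤a+b b≤k = ≰⇒> λ a≤k →
  <⇒≱ (+-mono-< (n<1+n k) (n<1+n k)) (≤-trans 2k+2≤a+b (+-mono-≤ a≤k b≤k))

m∸n+o≤p : ∀ {m n o p} → n ≤ m → m + o ≤ p + n → m ∸ n + o ≤ p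
m∸n+o≤p {m} {n} {o} {p} n≤m m+o≤p+n = begin
  m ∸ n + o   ≡⟨ +-∸-comm o n≤m ⟨
  m + o ∸ n   ≤⟨ ∸-monoˡ-≤ n m+o≤p+n ⟩
  p + n ∸ n   ≡⟨ m+n∸n≡m p n ⟩
  p           ∎
  where open ≤-Reasoning

module Expansion {n m} (t : ℕ) (M : Matroid n) (N : Matroid m) (π : Fin m → Fin n)
                 (expansion : IsExpansion t M N π) where

  open Σ expansion renaming (proj₁ to fibres; proj₂ to cyclic)
  open Σ cyclic renaming (proj₁ to cyclicFlats; proj₂ to cyclicFlatRank)

  S : Subset n → Subset m
  S = S[ π ]

  ∣S∣ : ∀ X → ∣ S X ∣ ≡ t * ∣ X ∣
  ∣S∣ = ∣S∣≡t*∣∣ π fibres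

  ∣S─S∣ : ∀ X A → ∣ S X ─ S A ∣ ≡ t * ∣ X ─ A ∣
  ∣S─S∣ X A = trans (cong ∣_∣ (sym (S-─ π X A))) (∣S∣ (X ─ A))

  ∣∁S∣ : ∀ X → ∣ ∁ (S X) ∣ ≡ t * ∣ ∁ X ∣
  ∣∁S∣ X = trans (cong ∣_∣ (sym (S-∁ π X))) (∣S∣ (∁ X))

  r[S]≤t*r : ∀ X → r N (S X) ≤ t * r M X
  r[S]≤t*r X with C , cyclicC , bound ← cyclicFlat-bound M X = begin
    r N (S X)                 ≤⟨ r≤r+∣─∣ N (S X) (S C) ⟩
    r N (S C) + ∣ S X ─ S C ∣ ≡⟨ cong₂ _+_ (cyclicFlatRank C cyclicC) (∣S─S∣ X C) ⟩
    t * r M C + t * ∣ X ─ C ∣ ≡⟨ *-distribˡ-+ t (r M C) _ ⟨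
    t * (r M C + ∣ X ─ C ∣)   ≤⟨ *-monoʳ-≤ t bound ⟩
    t * r M X                 ∎
    where open ≤-Reasoning

  cyclicFlat-bound-S : ∀ Y → ∃ λ A → t * r M A + ∣ Y ─ S A ∣ ≤ r N Y
  cyclicFlat-bound-S Y with Z , cyclicZ , bound ← cyclicFlat-bound N Y
                       with A , cyclicA , refl ← Equivalence.to (cyclicFlats Z) cyclicZ
    = A , subst (λ rZ → rZ + ∣ Y ─ S A ∣ ≤ r N Y) (cyclicFlatRank A cyclicA) bound

  r⊤≡t*r⊤ : r N ⊤ ≡ t * r M ⊤
  r⊤≡t*r⊤ with A , bound ← cyclicFlat-bound-S ⊤ = ≤-antisym upper lower
    where
    open ≤-Reasoning
    upper : r N ⊤ ≤ t * r M ⊤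
    upper = subst (λ T → r N T ≤ t * r M ⊤) (S-⊤ π) (r[S]≤t*r ⊤)
    lower : t * r M ⊤ ≤ r N ⊤
    lower = begin
      t * r M ⊤                 ≤⟨ *-monoʳ-≤ t (r≤r+∣─∣ M ⊤ A) ⟩
      t * (r M A + ∣ ⊤ ─ A ∣)   ≡⟨ *-distribˡ-+ t (r M A) _ ⟩
      t * r M A + t * ∣ ⊤ ─ A ∣ ≡⟨ cong (t * r M A +_) (trans (cong (λ T → ∣ T ─ S A ∣) (sym (S-⊤ π))) (∣S─S∣ ⊤ A)) ⟨
      t * r M A + ∣ ⊤ ─ S A ∣   ≤⟨ bound ⟩
      r N ⊤                     ∎

  conn[S]≤t*conn : ∀ X → conn N (S X) ≤ t * conn M X
  conn[S]≤t*conn X = begin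
    r N (S X) + r N (∁ (S X)) ∸ r N ⊤       ≡⟨ cong (λ T → r N (S X) + r N T ∸ r N ⊤) (S-∁ π X) ⟨
    r N (S X) + r N (S (∁ X)) ∸ r N ⊤       ≤⟨ ∸-mono (+-mono-≤ (r[S]≤t*r X) (r[S]≤t*r (∁ X))) (≤-reflexive (sym r⊤≡t*r⊤)) ⟩
    t * r M X + t * r M (∁ X) ∸ t * r M ⊤   ≡⟨ cong (_∸ t * r M ⊤) (*-distribˡ-+ t (r M X) _) ⟨
    t * (r M X + r M (∁ X)) ∸ t * r M ⊤     ≡⟨ *-distribˡ-∸ t (r M X + r M (∁ X)) (r M ⊤) ⟨
    t * conn M X                            ∎
    where open ≤-Reasoning

  S-separation : 1 ≤ t → ∀ {k X} → IsSeparation M (suc k) X → IsSeparation N (t * k + 1) (S X)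
  S-separation 1≤t {k} {X} (k<∣X∣ , k<∣∁X∣ , λ≤k) =
      subst (t * k + 1 ≤_) (sym (∣S∣ X)) (scaled k<∣X∣)
    , subst (t * k + 1 ≤_) (sym (∣∁S∣ X)) (scaled k<∣∁X∣)
    , subst (conn N (S X) <_) (+-comm 1 (t * k)) (s≤s (≤-trans (conn[S]≤t*conn X) (*-monoʳ-≤ t (m<1+n⇒m≤n λ≤k))))
    where
    scaled : ∀ {x} → suc k ≤ x → t * k + 1 ≤ t * x
    scaled {x} k<x = begin
      t * k + 1   ≤⟨ +-monoʳ-≤ (t * k) 1≤t ⟩
      t * k + t   ≡⟨ trans (+-comm (t * k) t) (sym (*-suc t k)) ⟩
      t * suc k   ≤⟨ *-monoʳ-≤ t k<x ⟩
      t * x       ∎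
      where open ≤-Reasoning

  interval-count-S : ∀ {Y A B X} → A ─ B ⊆ X → X ⊆ ∁ (B ─ A) →
    t * ∣ X ─ A ∣ + (t * ∣ ∁ X ─ B ∣ + (∣ Y ∩ S (B ─ A) ∣ + ∣ ∁ Y ∩ S (A ─ B) ∣))
      ≤ ∣ Y ─ S A ∣ + ∣ ∁ Y ─ S B ∣
  interval-count-S {Y} {A} {B} {X} A─B⊆X X⊆∁[B─A] = begin
    t * ∣ X ─ A ∣ + (t * ∣ ∁ X ─ B ∣ + (∣ Y ∩ S (B ─ A) ∣ + ∣ ∁ Y ∩ S (A ─ B) ∣))
      ≡⟨ cong₂ (λ u v → u + (v + _)) (∣S─S∣ X A)
               (trans (cong (λ T → ∣ T ─ S B ∣) (sym (S-∁ π X))) (∣S─S∣ (∁ X) B)) ⟨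
    ∣ S X ─ S A ∣ + (∣ ∁ (S X) ─ S B ∣ + (∣ Y ∩ S (B ─ A) ∣ + ∣ ∁ Y ∩ S (A ─ B) ∣))
      ≡⟨ cong₂ (λ SQ SP → ∣ S X ─ S A ∣ + (∣ ∁ (S X) ─ S B ∣ + (∣ Y ∩ SQ ∣ + ∣ ∁ Y ∩ SP ∣)))
               (S-─ π B A) (S-─ π A B) ⟩
    ∣ S X ─ S A ∣ + (∣ ∁ (S X) ─ S B ∣ + (∣ Y ∩ (S B ─ S A) ∣ + ∣ ∁ Y ∩ (S A ─ S B) ∣))
      ≤⟨ interval-count (S A) (S B) (S X) Y
           (subst (_⊆ S X) (S-─ π A B) (S-mono π A─B⊆X))
           (subst (S X ⊆_) (trans (S-∁ π (B ─ A)) (cong ∁ (S-─ π B A))) (S-mono π X⊆∁[B─A])) ⟩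
    ∣ Y ─ S A ∣ + ∣ ∁ Y ─ S B ∣
      ∎
    where open ≤-Reasoning

  t*conn+excess≤conn : ∀ {Y A B X} →
    t * r M A + ∣ Y ─ S A ∣ ≤ r N Y → t * r M B + ∣ ∁ Y ─ S B ∣ ≤ r N (∁ Y) →
    A ─ B ⊆ X → X ⊆ ∁ (B ─ A) →
    t * conn M X + (∣ Y ∩ S (B ─ A) ∣ + ∣ ∁ Y ∩ S (A ─ B) ∣) ≤ conn N Y
  t*conn+excess≤conn {Y} {A} {B} {X} boundA boundB A─B⊆X X⊆∁[B─A] =
    subst (_≤ conn N Y) (cong (_+ E) (sym (*-distribˡ-∸ t (r M X + r M (∁ X)) (r M ⊤))))
      (m∸n+o≤p (*-monoʳ-≤ t (r⊤≤r+r∁ M X)) (begin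
        t * (r M X + r M (∁ X)) + E
          ≤⟨ +-monoˡ-≤ E (*-monoʳ-≤ t (+-mono-≤ (r≤r+∣─∣ M X A) (r≤r+∣─∣ M (∁ X) B))) ⟩
        t * ((r M A + ∣ X ─ A ∣) + (r M B + ∣ ∁ X ─ B ∣)) + E
          ≡⟨ distribute t (r M A) (∣ X ─ A ∣) (r M B) (∣ ∁ X ─ B ∣) E ⟩
        (t * r M A + t * r M B) + (t * ∣ X ─ A ∣ + (t * ∣ ∁ X ─ B ∣ + E))
          ≤⟨ +-monoʳ-≤ (t * r M A + t * r M B) (interval-count-S {Y} A─B⊆X X⊆∁[B─A]) ⟩
        (t * r M A + t * r M B) + (∣ Y ─ S A ∣ + ∣ ∁ Y ─ S B ∣)
          ≡⟨ interchange (t * r M A) (t * r M B) (∣ Y ─ S A ∣) (∣ ∁ Y ─ S B ∣) ⟩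
        (t * r M A + ∣ Y ─ S A ∣) + (t * r M B + ∣ ∁ Y ─ S B ∣)
          ≤⟨ +-mono-≤ boundA boundB ⟩
        r N Y + r N (∁ Y)
          ≤⟨ m≤n+m∸n (r N Y + r N (∁ Y)) (r N ⊤) ⟩
        r N ⊤ + conn N Y
          ≡⟨ trans (+-comm (r N ⊤) (conn N Y)) (cong (conn N Y +_) r⊤≡t*r⊤) ⟩
        conn N Y + t * r M ⊤
          ∎))
    where
    open ≤-Reasoning
    E : ℕ
    E = ∣ Y ∩ S (B ─ A) ∣ + ∣ ∁ Y ∩ S (A ─ B) ∣
    distribute : ∀ t x a y b e → t * ((x + a) + (y + b)) + e ≡ (t * x + t * y) + (t * a + (t * b + e))
    distribute = solve-∀

  module NoSmallSeparation {k} (noSeparation : ∀ j → j < suc k → ∀ X → ¬ IsSeparation M j X)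
                           (2k+2≤n : suc k + suc k ≤ n)
                           {j} (j≤tk : j ≤ t * k) {Y}
                           (j≤∣Y∣ : j ≤ ∣ Y ∣) (j≤∣∁Y∣ : j ≤ ∣ ∁ Y ∣) (λY<j : conn N Y < j)
                           {A} (boundA : t * r M A + ∣ Y ─ S A ∣ ≤ r N Y)
                           {B} (boundB : t * r M B + ∣ ∁ Y ─ S B ∣ ≤ r N (∁ Y)) where

    P Q : Subset n
    P = A ─ B
    Q = B ─ A

    E : ℕ
    E = ∣ Y ∩ S Q ∣ + ∣ ∁ Y ∩ S P ∣

    P⊆∁Q : P ⊆ ∁ Q
    P⊆∁Q x∈P = x∉p⇒x∈∁p (λ x∈Q → x∈p─q⇒x∉q x∈P (p─q⊆p B A x∈Q))

    size-split : ∀ X → suc k + suc k ≤ ∣ X ∣ + ∣ ∁ X ∣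
    size-split X = subst (suc k + suc k ≤_) (sym (∣p∣+∣∁p∣≡n X)) 2k+2≤n

    bounded : ∀ {X} → P ⊆ X → X ⊆ ∁ Q → t * conn M X + E < j
    bounded P⊆X X⊆∁Q = ≤-<-trans (t*conn+excess≤conn boundA boundB P⊆X X⊆∁Q) λY<j

    conn<k : ∀ {X} → P ⊆ X → X ⊆ ∁ Q → conn M X < k
    conn<k P⊆X X⊆∁Q = *-cancelˡ-< t _ _ (<-≤-trans (≤-<-trans (m≤m+n _ E) (bounded P⊆X X⊆∁Q)) j≤tk)

    unbalanced : ∀ {X} → P ⊆ X → X ⊆ ∁ Q → ∣ X ∣ ≤ conn M X ⊎ ∣ ∁ X ∣ ≤ conn M X
    unbalanced P⊆X X⊆∁Q = small⊎cosmall M noSeparation _ (s≤s (conn<k P⊆X X⊆∁Q))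

    P-not-cosmall : ¬ ∣ ∁ P ∣ ≤ conn M P
    P-not-cosmall cosmall = <⇒≱ (begin-strict
      ∣ ∁ Y ∣                       ≤⟨ ∣p∣≤∣∁q∣+∣p∩q∣ (∁ Y) (S P) ⟩
      ∣ ∁ (S P) ∣ + ∣ ∁ Y ∩ S P ∣   ≡⟨ cong (_+ ∣ ∁ Y ∩ S P ∣) (∣∁S∣ P) ⟩
      t * ∣ ∁ P ∣ + ∣ ∁ Y ∩ S P ∣   ≤⟨ +-mono-≤ (*-monoʳ-≤ t cosmall) (m≤n+m _ _) ⟩
      t * conn M P + E              <⟨ bounded ⊆-refl P⊆∁Q ⟩
      j                             ∎) j≤∣∁Y∣
      where open ≤-Reasoning

    ∁Q-not-small : ¬ ∣ ∁ Q ∣ ≤ conn M (∁ Q)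
    ∁Q-not-small small = <⇒≱ (begin-strict
      ∣ Y ∣                         ≤⟨ ∣p∣≤∣∁q∣+∣p∩q∣ Y (S Q) ⟩
      ∣ ∁ (S Q) ∣ + ∣ Y ∩ S Q ∣     ≡⟨ cong (_+ ∣ Y ∩ S Q ∣) (∣∁S∣ Q) ⟩
      t * ∣ ∁ Q ∣ + ∣ Y ∩ S Q ∣     ≤⟨ +-mono-≤ (*-monoʳ-≤ t small) (m≤m+n _ _) ⟩
      t * conn M (∁ Q) + E          <⟨ bounded P⊆∁Q ⊆-refl ⟩
      j                             ∎) j≤∣Y∣
      where open ≤-Reasoning

    ∣P∣<k : ∣ P ∣ < k
    ∣P∣<k = [ (λ small → ≤-<-trans small (conn<k ⊆-refl P⊆∁Q)) , ⊥-elim ∘ P-not-cosmall ]′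
              (unbalanced ⊆-refl P⊆∁Q)

    k<∣∁Q∣ : k < ∣ ∁ Q ∣
    k<∣∁Q∣ = [ ⊥-elim ∘ ∁Q-not-small
             , (λ cosmall → left-summand-large (size-split (∁ Q))
                              (<⇒≤ (≤-<-trans cosmall (conn<k P⊆∁Q ⊆-refl))))
             ]′ (unbalanced P⊆∁Q ⊆-refl)

    impossible : ⊥
    impossible =
      let X , P⊆X , X⊆∁Q , ∣X∣≡k = interpolate P⊆∁Q (<⇒≤ ∣P∣<k) (<⇒≤ k<∣∁Q∣)
      in  [ (λ small → <⇒≱ (conn<k P⊆X X⊆∁Q) (subst (_≤ conn M X) ∣X∣≡k small))
          , (λ cosmall → <-irrefl (sym ∣X∣≡k) (left-summand-large (size-split X)
                           (<⇒≤ (≤-<-trans cosmall (conn<k P⊆X X⊆∁Q)))))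
          ]′ (unbalanced P⊆X X⊆∁Q)

theorem4p1 : ∀ {n m} (t : ℕ) → 1 ≤ t → (M : Matroid n) (N : Matroid m) (π : Fin m → Fin n) →
    IsExpansion t M N π → FiniteTutteConn M →
    ∀ k → TutteConnIs M k → TutteConnIs N (t * (k ∸ 1) + 1)
-- τ(M) < ∞ is already part of TutteConnIs M k.
theorem4p1 t 1≤t M N π expansion _ zero ((_ , _ , _ , ()) , _)
theorem4p1 {n} t 1≤t M N π expansion _ (suc k) ((X , sepX@(k<∣X∣ , k<∣∁X∣ , _)) , noSeparation) =
    (S X , S-separation 1≤t sepX)
  , λ j j<tk+1 Y (j≤∣Y∣ , j≤∣∁Y∣ , λY<j) →
      let A , boundA = cyclicFlat-bound-S Y
          B , boundB = cyclicFlat-bound-S (∁ Y)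
      in  NoSmallSeparation.impossible noSeparation 2k+2≤n (j≤tk j<tk+1) j≤∣Y∣ j≤∣∁Y∣ λY<j boundA boundB
  where
  open Expansion t M N π expansion
  2k+2≤n : suc k + suc k ≤ n
  2k+2≤n = subst (suc k + suc k ≤_) (∣p∣+∣∁p∣≡n X) (+-mono-≤ k<∣X∣ k<∣∁X∣)
  j≤tk : ∀ {j} → j < t * k + 1 → j ≤ t * k
  j≤tk {j} = m<1+n⇒m≤n ∘ subst (j <_) (+-comm (t * k) 1)
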